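{- Let $q=p^e$ with $p$ prime and $e\geq 1$, and let $m$ be a positive integer with $m+2<q$. If $(i,j)\in\{(m,m+2),(m+1,m+2),(m,m+1)\}$, then the diameter of the jumped Wenger graph $J_m(q,i,j)$ is $2(m+1)$.
   Context: Jumped Wenger graph: for a prime power $q$, a positive integer $m$ and integers $1\le i<j\le m+2$, let $(f_1(x),\dots,f_{m+1}(x))$ be the list of monomials $x^k$, $k\in\{0,1,\dots,m+2\}\setminus\{i,j\}$, in increasing order of exponent (so $f_1=1$). $J_m(q,i,j)$ is the bipartite graph whose vertex set is the disjoint union of the point set $\mathbb{F}_q^{m+1}$ (points $P=(p_1,\dots,p_{m+1})$) and the line set $\mathbb{F}_q^{m+1}$ (lines $L=[l_1,\dots,l_{m+1}]$), where $P$ is adjacent to $L$ iff $l_k+p_k=l_1 f_k(p_1)$ for all $k=2,\dots,m+1$. The diameter is the maximum, over all pairs of vertices, of the number of edges in a shortest path joining them. -}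

module Defs where

open import Level using (0ℓ)
open import Data.Nat using (ℕ; zero; suc; _+_; _∸_; _<ᵇ_; _≤_)
open import Data.Bool using (if_then_else_)
open import Data.Fin using (Fin; toℕ) renaming (zero to fzero)
open import Data.Sum using (_⊎_; inj₁; inj₂)
open import Data.Product using (Σ; ∃; ∃-syntax; _×_)
open import Data.Empty using (⊥)
open import Relation.Nullary using (¬_)
open import Relation.Binary.PropositionalEquality using (_≡_; _≢_)
open import Algebra.Structures using (IsCommutativeRing)
open import Function.Bundles using (_↔_)

record FiniteField (q : ℕ) : Set₁ where
  infixl 6 _+F_
  infixl 7 _*F_
  field
    Carrier   : Set
    _+F_ _*F_ : Carrier → Carrier → Carrier
    -F_       : Carrier → Carrier
    0F 1F     : Carrier
    isCommutativeRing : IsCommutativeRing _≡_ _+F_ _*F_ -F_ 0F 1F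
    0≢1       : 0F ≢ 1F
    inverse   : ∀ x → x ≢ 0F → ∃[ y ] (x *F y ≡ 1F)
    card      : Carrier ↔ Fin q

  pow : Carrier → ℕ → Carrier
  pow x zero    = 1F
  pow x (suc n) = x *F pow x n

-- Exponent of the (t+1)-th monomial f_{t+1}: the t-th (0-based) element, in increasing
-- order, of {0,1,...,m+2} \ {i,j}, assuming 1 ≤ i < j ≤ m+2.
expo : (i j t : ℕ) → ℕ
expo i j t = if t <ᵇ i then t else (if t <ᵇ (j ∸ 1) then suc t else t + 2)

module JumpedWenger {q : ℕ} (F : FiniteField q) (m i j : ℕ) where
  open FiniteField F

  Point : Set
  Point = Fin (suc m) → Carrier   -- coordinate index t ↔ p_{t+1}

  Line : Set
  Line = Fin (suc m) → Carrier

  Incident : Point → Line → Set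
  Incident P L = ∀ (t : Fin (suc m)) → 1 ≤ toℕ t →
    L t +F P t ≡ L fzero *F pow (P fzero) (expo i j (toℕ t))

  Vertex : Set
  Vertex = Point ⊎ Line

  Adj : Vertex → Vertex → Set
  Adj (inj₁ P) (inj₂ L) = Incident P L
  Adj (inj₂ L) (inj₁ P) = Incident P L
  Adj (inj₁ _) (inj₁ _) = ⊥
  Adj (inj₂ _) (inj₂ _) = ⊥

data Walk {V : Set} (Adj : V → V → Set) : V → V → ℕ → Set where
  nil  : ∀ {u} → Walk Adj u u 0
  cons : ∀ {u w v n} → Adj u w → Walk Adj w v n → Walk Adj u v (suc n)

HasDiameter : {V : Set} → (V → V → Set) → ℕ → Set
HasDiameter {V} Adj d =
  (∀ (u v : V) → ∃[ k ] (k ≤ d × Walk Adj u v k)) ×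
  (∃[ u ] ∃[ v ] (∀ k → Walk Adj u v k → d ≤ k))

module Submission where

-- Index coordinates from 0, so that p_t carries the exponent e_t = expo i j t. A walk
-- P₀ L₁ P₁ … L_s P_s between points shifts each p_t (t ≥ 1) by Σ_r a_r (x_r^{e_t} − x_{r−1}^{e_t}),
-- where a_r is the first coordinate of L_r and x_r that of P_r: by a power sum Σ c_x x^{e_t} of total
-- weight 0 over the first coordinates visited. For i ≥ m, e_t = t for t < m and e_m = m + k, k ≤ 2.
-- Upper bound: on m + 1 distinct nodes the moments of orders 0, …, m − 1 and m + k can be prescribed
-- as soon as the complete homogeneous polynomial h_k of the nodes is nonzero; h_k has degree k ≤ 2 in
-- the last node, so q > m + 2 leaves room to choose it. Hence every change of p_1, …, p_m is realised
-- by a walk of length 2m, and any two vertices are at distance at most 2m + 2.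
-- Lower bound: a shorter walk from the origin to the point with p_m = 1 has fewer than m interior
-- points, and a power sum on fewer than m nodes whose moments of orders 1, …, m − 1 vanish has all
-- positive moments zero (Vandermonde), contradicting p_m = 1.

open import Algebra.Bundles using (CommutativeRing)

-- The coefficients have to be integers (rather than ring elements) so that the
-- solver's normal forms are compared by computation.
module IntegerRingSolver {c ℓ} (R : CommutativeRing c ℓ) where
  open import Data.Nat.Base as ℕ using (zero; suc)
  import Data.Nat.Properties as ℕ
  open import Data.Integer.Base as ℤ using (ℤ; +_; -[1+_]; _⊖_; _◃_; sign; ∣_∣)
  import Data.Integer.Properties as ℤ
  open import Data.Sign.Base as Sign using (Sign)
  open import Data.Maybe.Base using (Maybe; just; nothing)
  open import Relation.Nullary.Decidable using (yes; no)
  import Relation.Binary.PropositionalEquality as ≡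
  open import Algebra.Solver.Ring.AlmostCommutativeRing
    using (_-Raw-AlmostCommutative⟶_; fromCommutativeRing)

  open CommutativeRing R
  open import Algebra.Properties.Ring ring using (-1*x≈-x; -‿involutive; -0#≈0#; -‿anti-homo-+; -‿+-comm)
  open import Algebra.Properties.Semiring.Mult.TCOptimised semiring using (_×_; 1+×; ×-homo-+; ×1-homo-*)
  open import Relation.Binary.Reasoning.Setoid setoid

  ⟦_⟧ℤ : ℤ → Carrier
  ⟦ + n ⟧ℤ      = n × 1#
  ⟦ -[1+ n ] ⟧ℤ = - (suc n × 1#)

  private
    sign⟦_⟧ : Sign → Carrier
    sign⟦ Sign.+ ⟧ = 1#
    sign⟦ Sign.- ⟧ = - 1#

    +-cancel-common : ∀ x a b → (x + a) - (x + b) ≈ a - b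
    +-cancel-common x a b = begin
      (x + a) - (x + b)    ≈⟨ +-cong (+-comm x a) (-‿cong (+-comm x b)) ⟩
      (a + x) - (b + x)    ≈⟨ +-congˡ (-‿anti-homo-+ b x) ⟩
      (a + x) + (- x - b)  ≈⟨ +-assoc a x _ ⟩
      a + (x + (- x - b))  ≈⟨ +-congˡ (+-assoc x (- x) (- b)) ⟨
      a + ((x - x) - b)    ≈⟨ +-congˡ (+-congʳ (-‿inverseʳ x)) ⟩
      a + (0# - b)         ≈⟨ +-congˡ (+-identityˡ (- b)) ⟩
      a - b                ∎

    ⊖-homo : ∀ m n → ⟦ m ⊖ n ⟧ℤ ≈ m × 1# - n × 1#
    ⊖-homo zero    zero    = sym (trans (+-identityˡ _) -0#≈0#)
    ⊖-homo zero    (suc n) = sym (+-identityˡ _)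
    ⊖-homo (suc m) zero    = sym (trans (+-congˡ -0#≈0#) (+-identityʳ _))
    ⊖-homo (suc m) (suc n) = begin
      ⟦ suc m ⊖ suc n ⟧ℤ       ≡⟨ ≡.cong ⟦_⟧ℤ (ℤ.[1+m]⊖[1+n]≡m⊖n m n) ⟩
      ⟦ m ⊖ n ⟧ℤ               ≈⟨ ⊖-homo m n ⟩
      m × 1# - n × 1#          ≈⟨ +-cancel-common 1# _ _ ⟨
      (1# + m × 1#) - (1# + n × 1#)  ≈⟨ +-cong (1+× m 1#) (-‿cong (1+× n 1#)) ⟨
      suc m × 1# - suc n × 1#  ∎

    +-homo : ∀ i j → ⟦ i ℤ.+ j ⟧ℤ ≈ ⟦ i ⟧ℤ + ⟦ j ⟧ℤ
    +-homo (+ m)    (+ n)    = ×-homo-+ 1# m n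
    +-homo (+ m)    -[1+ n ] = ⊖-homo m (suc n)
    +-homo -[1+ m ] (+ n)    = trans (⊖-homo n (suc m)) (+-comm _ _)
    +-homo -[1+ m ] -[1+ n ] = begin
      - (suc (suc (m ℕ.+ n)) × 1#)   ≡⟨ ≡.cong (λ k → - (k × 1#)) (≡.sym (ℕ.+-suc (suc m) n)) ⟩
      - ((suc m ℕ.+ suc n) × 1#)     ≈⟨ -‿cong (×-homo-+ 1# (suc m) (suc n)) ⟩
      - (suc m × 1# + suc n × 1#)    ≈⟨ -‿+-comm _ _ ⟨
      ⟦ -[1+ m ] ⟧ℤ + ⟦ -[1+ n ] ⟧ℤ  ∎

    -‿homo : ∀ i → ⟦ ℤ.- i ⟧ℤ ≈ - ⟦ i ⟧ℤ
    -‿homo (+ zero)  = sym -0#≈0#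
    -‿homo (+ suc n) = refl
    -‿homo -[1+ n ]  = sym (-‿involutive _)

    ◃-homo : ∀ s n → ⟦ s ◃ n ⟧ℤ ≈ sign⟦ s ⟧ * (n × 1#)
    ◃-homo s      zero    = sym (zeroʳ _)
    ◃-homo Sign.+ (suc n) = sym (*-identityˡ _)
    ◃-homo Sign.- (suc n) = sym (-1*x≈-x _)

    sign-homo : ∀ s t → sign⟦ s Sign.* t ⟧ ≈ sign⟦ s ⟧ * sign⟦ t ⟧
    sign-homo Sign.+ t      = sym (*-identityˡ _)
    sign-homo Sign.- Sign.+ = sym (*-identityʳ _)
    sign-homo Sign.- Sign.- = sym (trans (-1*x≈-x _) (-‿involutive 1#))

    sign-abs : ∀ i → ⟦ i ⟧ℤ ≈ sign⟦ sign i ⟧ * (∣ i ∣ × 1#)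
    sign-abs i = trans (reflexive (≡.cong ⟦_⟧ℤ (≡.sym (ℤ.◃-inverse i)))) (◃-homo (sign i) ∣ i ∣)

    *-interchange : ∀ a b x y → (a * b) * (x * y) ≈ (a * x) * (b * y)
    *-interchange a b x y = begin
      (a * b) * (x * y)  ≈⟨ *-assoc a b _ ⟩
      a * (b * (x * y))  ≈⟨ *-congˡ (*-assoc b x y) ⟨
      a * ((b * x) * y)  ≈⟨ *-congˡ (*-congʳ (*-comm b x)) ⟩
      a * ((x * b) * y)  ≈⟨ *-congˡ (*-assoc x b y) ⟩
      a * (x * (b * y))  ≈⟨ *-assoc a x _ ⟨
      (a * x) * (b * y)  ∎

    *-homo : ∀ i j → ⟦ i ℤ.* j ⟧ℤ ≈ ⟦ i ⟧ℤ * ⟦ j ⟧ℤ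
    *-homo i j = begin
      ⟦ sign i Sign.* sign j ◃ ∣ i ∣ ℕ.* ∣ j ∣ ⟧ℤ
        ≈⟨ ◃-homo (sign i Sign.* sign j) (∣ i ∣ ℕ.* ∣ j ∣) ⟩
      sign⟦ sign i Sign.* sign j ⟧ * ((∣ i ∣ ℕ.* ∣ j ∣) × 1#)
        ≈⟨ *-cong (sign-homo (sign i) (sign j)) (×1-homo-* ∣ i ∣ ∣ j ∣) ⟩
      (sign⟦ sign i ⟧ * sign⟦ sign j ⟧) * ((∣ i ∣ × 1#) * (∣ j ∣ × 1#))
        ≈⟨ *-interchange _ _ _ _ ⟩
      (sign⟦ sign i ⟧ * (∣ i ∣ × 1#)) * (sign⟦ sign j ⟧ * (∣ j ∣ × 1#))
        ≈⟨ *-cong (sign-abs i) (sign-abs j) ⟨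
      ⟦ i ⟧ℤ * ⟦ j ⟧ℤ
        ∎

    morphism : ℤ.+-*-rawRing -Raw-AlmostCommutative⟶ fromCommutativeRing R
    morphism = record
      { ⟦_⟧ = ⟦_⟧ℤ ; +-homo = +-homo ; *-homo = *-homo ; -‿homo = -‿homo
      ; 0-homo = refl ; 1-homo = refl }

    ⟦⟧ℤ-equal? : ∀ i j → Maybe (⟦ i ⟧ℤ ≈ ⟦ j ⟧ℤ)
    ⟦⟧ℤ-equal? i j with i ℤ.≟ j
    ... | yes i≡j = just (reflexive (≡.cong ⟦_⟧ℤ i≡j))
    ... | no _    = nothing

  open import Algebra.Solver.Ring ℤ.+-*-rawRing (fromCommutativeRing R) morphism ⟦⟧ℤ-equal? public

open import Defs
open import Data.Nat using (ℕ; _+_; _*_; _^_; _≤_; _<_)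
open import Data.Nat.Primality using (Prime)
open import Data.Sum using (_⊎_)
open import Data.Product using (_×_)
open import Relation.Binary.PropositionalEquality using (_≡_)

open import Level using (0ℓ)
open import Function.Base using (id; _∘_)
open import Function.Properties.Inverse using (↔⇒↣)
open import Function.Bundles using (module Inverse)
open import Data.Nat using (zero; suc; pred; z≤n; s≤s; _<?_; _≤?_; _<ᵇ_; _∸_)
open import Data.Bool using (true; false)
import Data.Nat.Properties as ℕ
open import Data.Integer.Base using (+_)
open import Data.Fin as Fin using (Fin; toℕ; fromℕ; fromℕ<) renaming (zero to fzero; suc to fsuc)
import Data.Fin.Properties as Fin
open import Data.List using (List; []; _∷_; length; map; lookup)
import Data.List.Properties as List
open import Data.List.Relation.Unary.All using (All; []; _∷_)
open import Data.List.Relation.Unary.All.Properties.Core using (¬Any⇒All¬)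
open import Data.List.Relation.Unary.Any as Any using (any?)
open import Data.List.Relation.Unary.Any.Properties using (lookup-index)
open import Data.List.Relation.Unary.AllPairs using ([]; _∷_)
open import Data.List.Relation.Unary.Unique.Propositional using (Unique)
open import Data.Product using (∃-syntax; _,_; proj₁; proj₂)
open import Data.Sum using (inj₁; inj₂)
import Data.Sum.Properties as Sum
open import Data.Empty using (⊥; ⊥-elim)
open import Relation.Nullary using (yes; no; contradiction)
open import Relation.Nullary.Decidable using (via-injection)
open import Relation.Binary.Definitions using (DecidableEquality)
open import Relation.Binary.PropositionalEquality
  using (_≢_; refl; sym; trans; cong; cong₂; subst; subst₂; ≢-sym; module ≡-Reasoning)
open import Algebra.Structures using (IsCommutativeRing)

expo-below : ∀ {i t} j → t < i → expo i j t ≡ t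
expo-below {i} {t} j t<i with t <ᵇ i | ℕ.<⇒<ᵇ t<i
... | true | _ = refl

expo-gap : ∀ i j t → ∃[ k ] k ≤ 2 × expo i j t ≡ t + k
expo-gap i j t with t <ᵇ i
... | true = 0 , z≤n , sym (ℕ.+-identityʳ t)
... | false with t <ᵇ (j ∸ 1)
...   | true  = 1 , s≤s z≤n , sym (ℕ.+-comm t 1)
...   | false = 2 , s≤s (s≤s z≤n) , refl

expo-≥ : ∀ i j t → t ≤ expo i j t
expo-≥ i j t with expo-gap i j t
... | k , _ , e≡t+k = subst (t ≤_) (sym e≡t+k) (ℕ.m≤m+n t k)

module FiniteFieldProperties {q : ℕ} (F : FiniteField q) where
  open FiniteField F
  open IsCommutativeRing isCommutativeRing public
    using (+-identityˡ; +-identityʳ; *-assoc; *-comm; *-identityˡ; *-identityʳ; zeroˡ; zeroʳ)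
  open Inverse card using (to; from; strictlyInverseˡ)
  open ≡-Reasoning

  commutativeRing : CommutativeRing 0ℓ 0ℓ
  commutativeRing = record { isCommutativeRing = isCommutativeRing }

  open IntegerRingSolver commutativeRing public using (solve; con; _:+_; _:*_; _:-_; _:=_)

  infixl 6 _-F_
  _-F_ : Carrier → Carrier → Carrier
  x -F y = x +F -F y

  [x-y]+y≡x : ∀ x y → (x -F y) +F y ≡ x
  [x-y]+y≡x = solve 2 (λ x y → (x :- y) :+ y := x) refl

  y+[x-y]≡x : ∀ x y → y +F (x -F y) ≡ x
  y+[x-y]≡x = solve 2 (λ x y → y :+ (x :- y) := x) refl

  x-y≡0⇒x≡y : ∀ {x y} → x -F y ≡ 0F → x ≡ y
  x-y≡0⇒x≡y {x} {y} x-y≡0 = trans (sym ([x-y]+y≡x x y)) (trans (cong (_+F y) x-y≡0) (+-identityˡ y))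

  x≡y⇒x-y≡0 : ∀ {x y} → x ≡ y → x -F y ≡ 0F
  x≡y⇒x-y≡0 {x} refl = solve 1 (λ x → x :- x := con (+ 0)) refl x

  x-y*0≡x : ∀ x y → x -F y *F 0F ≡ x
  x-y*0≡x = solve 2 (λ x y → x :- y :* con (+ 0) := x) refl

  x+y*0≡x : ∀ x y → x +F y *F 0F ≡ x
  x+y*0≡x = solve 2 (λ x y → x :+ y :* con (+ 0) := x) refl

  a≡b+c⇒c≡a-b : ∀ {a b c} → a ≡ b +F c → c ≡ a -F b
  a≡b+c⇒c≡a-b {a} {b} {c} a≡b+c =
    trans (solve 2 (λ b c → c := (b :+ c) :- b) refl b c) (cong (_-F b) (sym a≡b+c))

  _≟_ : DecidableEquality Carrier
  _≟_ = via-injection (↔⇒↣ card) Fin._≟_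

  -- 0F ⁻¹ is the junk value 0F.
  _⁻¹ : Carrier → Carrier
  x ⁻¹ with x ≟ 0F
  ... | yes _   = 0F
  ... | no x≢0 = proj₁ (inverse x x≢0)

  ⁻¹-inverseˡ : ∀ {x} → x ≢ 0F → x ⁻¹ *F x ≡ 1F
  ⁻¹-inverseˡ {x} x≢0 with x ≟ 0F
  ... | yes x≡0 = contradiction x≡0 x≢0
  ... | no x≢0 = trans (*-comm _ x) (proj₂ (inverse x x≢0))

  *-cancel-nonzeroˡ : ∀ {x y} → x ≢ 0F → x *F y ≡ 0F → y ≡ 0F
  *-cancel-nonzeroˡ {x} {y} x≢0 xy≡0 = begin
    y                  ≡⟨ sym (*-identityˡ y) ⟩
    1F *F y            ≡⟨ cong (_*F y) (⁻¹-inverseˡ x≢0) ⟨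
    x ⁻¹ *F x *F y     ≡⟨ *-assoc (x ⁻¹) x y ⟩
    x ⁻¹ *F (x *F y)   ≡⟨ cong (x ⁻¹ *F_) xy≡0 ⟩
    x ⁻¹ *F 0F         ≡⟨ zeroʳ (x ⁻¹) ⟩
    0F                 ∎

  ∃-fresh : (xs : List Carrier) → length xs < q → ∃[ y ] All (y ≢_) xs
  ∃-fresh xs |xs|<q with Fin.all? (λ k → any? (from k ≟_) xs)
  ... | no ¬covered =
    let k , k∉xs = Fin.¬∀⟶∃¬ q _ (λ k → any? (from k ≟_) xs) ¬covered
    in from k , ¬Any⇒All¬ xs k∉xs
  ... | yes covered =
    let k , k′ , k<k′ , same-index = Fin.pigeonhole |xs|<q (λ k → Any.index (covered k))
    in contradiction (from-injective (trans (lookup-index (covered k))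
                        (trans (cong (lookup xs) same-index) (sym (lookup-index (covered k′))))))
                     (Fin.<⇒≢ k<k′)
    where
    from-injective : ∀ {k k′} → from k ≡ from k′ → k ≡ k′
    from-injective {k} {k′} eq = trans (sym (strictlyInverseˡ k)) (trans (cong to eq) (strictlyInverseˡ k′))

  ∃-unique-extension : ∀ n (x : Carrier) → n < q → ∃[ zs ] length zs ≡ n × Unique (x ∷ zs)
  ∃-unique-extension zero    x _   = [] , refl , [] ∷ []
  ∃-unique-extension (suc n) x n<q with ∃-unique-extension n x (ℕ.<⇒≤ n<q)
  ... | zs , refl , x∉zs ∷ zs-unique with ∃-fresh (x ∷ zs) n<q
  ...   | z , z≢x ∷ z∉zs = z ∷ zs , refl , (≢-sym z≢x ∷ x∉zs) ∷ (z∉zs ∷ zs-unique)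

  AtMostTwoRoots : (Carrier → Carrier) → Set
  AtMostTwoRoots f = ∀ {a b c} → f a ≡ 0F → f b ≡ 0F → f c ≡ 0F → a ≢ b → a ≢ c → b ≢ c → ⊥

  ∃-fresh-nonroot : ∀ f → AtMostTwoRoots f → (xs : List Carrier) → 2 + length xs < q →
    ∃[ y ] All (y ≢_) xs × f y ≢ 0F
  ∃-fresh-nonroot f roots xs 2+|xs|<q with ∃-fresh xs (ℕ.<⇒≤ (ℕ.<⇒≤ 2+|xs|<q))
  ... | a , a∉xs with f a ≟ 0F
  ...   | no fa≢0 = a , a∉xs , fa≢0
  ...   | yes fa≡0 with ∃-fresh (a ∷ xs) (ℕ.<⇒≤ 2+|xs|<q)
  ...     | b , b≢a ∷ b∉xs with f b ≟ 0F
  ...       | no fb≢0 = b , b∉xs , fb≢0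
  ...       | yes fb≡0 with ∃-fresh (b ∷ a ∷ xs) 2+|xs|<q
  ...         | c , c≢b ∷ c≢a ∷ c∉xs with f c ≟ 0F
  ...           | no fc≢0 = c , c∉xs , fc≢0
  ...           | yes fc≡0 = ⊥-elim (roots fa≡0 fb≡0 fc≡0 (≢-sym b≢a) (≢-sym c≢a) (≢-sym c≢b))

module PowerSums {q : ℕ} (F : FiniteField q) where
  open FiniteField F
  open FiniteFieldProperties F
  open ≡-Reasoning

  Weighted : Set
  Weighted = List (Carrier × Carrier)

  nodes : Weighted → List Carrier
  nodes = map proj₁

  moment : ℕ → Weighted → Carrier
  moment k []            = 0F
  moment k ((x , c) ∷ w) = c *F pow x k +F moment k w

  reweight : (Carrier → Carrier) → Weighted → Weighted
  reweight f = map λ (x , c) → x , c *F f x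

  nodes-reweight : ∀ f w → nodes (reweight f w) ≡ nodes w
  nodes-reweight f w = sym (List.map-∘ w)

  moment-reweight-sub : ∀ y k w → moment k (reweight (_-F y) w) ≡ moment (suc k) w -F y *F moment k w
  moment-reweight-sub y k []            = sym (x-y*0≡x 0F y)
  moment-reweight-sub y k ((x , c) ∷ w) = begin
    c *F (x -F y) *F pow x k +F moment k (reweight (_-F y) w)
      ≡⟨ cong (c *F (x -F y) *F pow x k +F_) (moment-reweight-sub y k w) ⟩
    c *F (x -F y) *F pow x k +F (moment (suc k) w -F y *F moment k w)
      ≡⟨ solve 6 (λ c x y p a b → c :* (x :- y) :* p :+ (a :- y :* b)
                                  := (c :* (x :* p) :+ a) :- y :* (c :* p :+ b))
               refl c x y (pow x k) (moment (suc k) w) (moment k w) ⟩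
    (c *F (x *F pow x k) +F moment (suc k) w) -F y *F (c *F pow x k +F moment k w)
      ∎

  moment-suc-cons : ∀ y c w k →
    moment (suc k) ((y , c) ∷ w) ≡ y *F moment k ((y , c) ∷ w) +F moment k (reweight (_-F y) w)
  moment-suc-cons y c w k = begin
    c *F (y *F pow y k) +F moment (suc k) w
      ≡⟨ solve 5 (λ c y p a b → c :* (y :* p) :+ a := y :* (c :* p :+ b) :+ (a :- y :* b))
               refl c y (pow y k) (moment (suc k) w) (moment k w) ⟩
    y *F (c *F pow y k +F moment k w) +F (moment (suc k) w -F y *F moment k w)
      ≡⟨ cong (y *F (c *F pow y k +F moment k w) +F_) (moment-reweight-sub y k w) ⟨
    y *F (c *F pow y k +F moment k w) +F moment k (reweight (_-F y) w)
      ∎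

  moment-reweight-node : ∀ k w → moment k (reweight id w) ≡ moment (suc k) w
  moment-reweight-node k []            = refl
  moment-reweight-node k ((x , c) ∷ w) = cong₂ _+F_ (*-assoc c x (pow x k)) (moment-reweight-node k w)

  moment-reweight-inverse : ∀ y k w → All (y ≢_) (nodes w) →
    moment k (reweight (_-F y) (reweight (λ x → (x -F y) ⁻¹) w)) ≡ moment k w
  moment-reweight-inverse y k []            []               = refl
  moment-reweight-inverse y k ((x , c) ∷ w) (y≢x ∷ y∉w) =
    cong₂ _+F_ (cong (_*F pow x k) weight) (moment-reweight-inverse y k w y∉w)
    where
    weight : c *F (x -F y) ⁻¹ *F (x -F y) ≡ c
    weight = begin
      c *F (x -F y) ⁻¹ *F (x -F y)    ≡⟨ *-assoc c _ _ ⟩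
      c *F ((x -F y) ⁻¹ *F (x -F y))  ≡⟨ cong (c *F_) (⁻¹-inverseˡ (y≢x ∘ sym ∘ x-y≡0⇒x≡y)) ⟩
      c *F 1F                         ≡⟨ *-identityʳ c ⟩
      c                               ∎

  moment-reweight-sub-cons : ∀ y c w k →
    moment k (reweight (_-F y) w) ≡ moment (suc k) ((y , c) ∷ w) -F y *F moment k ((y , c) ∷ w)
  moment-reweight-sub-cons y c w k = a≡b+c⇒c≡a-b (moment-suc-cons y c w k)

  moments-vanish : ∀ w → (∀ e → e < length w → moment e w ≡ 0F) → ∀ k → moment k w ≡ 0F
  moments-vanish []            _   _ = refl
  moments-vanish ((y , c) ∷ w) low = vanish
    where
    shifted-low : ∀ e → e < length (reweight (_-F y) w) → moment e (reweight (_-F y) w) ≡ 0F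
    shifted-low e e<|w| = begin
      moment e (reweight (_-F y) w)                                ≡⟨ moment-reweight-sub-cons y c w e ⟩
      moment (suc e) ((y , c) ∷ w) -F y *F moment e ((y , c) ∷ w)  ≡⟨ cong₂ (λ a b → a -F y *F b)
                                                                        (low (suc e) (s≤s e<|w|′)) (low e (ℕ.m<n⇒m<1+n e<|w|′)) ⟩
      0F -F y *F 0F                                                ≡⟨ x-y*0≡x 0F y ⟩
      0F                                                           ∎
      where
      e<|w|′ : e < length w
      e<|w|′ = subst (e <_) (List.length-map _ w) e<|w|

    vanish : ∀ k → moment k ((y , c) ∷ w) ≡ 0F
    vanish zero    = low 0 (s≤s z≤n)
    vanish (suc k) = begin
      moment (suc k) ((y , c) ∷ w)                                  ≡⟨ moment-suc-cons y c w k ⟩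
      y *F moment k ((y , c) ∷ w) +F moment k (reweight (_-F y) w)  ≡⟨ cong₂ (λ a b → y *F a +F b) (vanish k)
                                                                         (moments-vanish (reweight (_-F y) w) shifted-low k) ⟩
      y *F 0F +F 0F                                                 ≡⟨ trans (+-identityʳ _) (zeroʳ y) ⟩
      0F                                                            ∎

  positive-moments-vanish : ∀ w → (∀ e → e < length w → moment (suc e) w ≡ 0F) → ∀ e → moment (suc e) w ≡ 0F
  positive-moments-vanish w low e =
    trans (sym (moment-reweight-node e w))
          (moments-vanish (reweight id w) (λ e e< → trans (moment-reweight-node e w)
                                                        (low e (subst (e <_) (List.length-map _ w) e<))) e)

  interpolate : ∀ S → Unique S → (T : ℕ → Carrier) →
    ∃[ w ] nodes w ≡ S × (∀ e → e < length S → moment e w ≡ T e)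
  interpolate []      _                      _ = [] , refl , λ _ ()
  interpolate (y ∷ S) (y∉S ∷ S-unique) T with interpolate S S-unique (λ e → T (suc e) -F y *F T e)
  ... | w , refl , w-moments = (y , T 0 -F moment 0 v) ∷ v , cong (y ∷_) (nodes-reweight _ w) , moments
    where
    v : Weighted
    v = reweight (λ x → (x -F y) ⁻¹) w

    moments : ∀ e → e < suc (length (nodes w)) → moment e ((y , T 0 -F moment 0 v) ∷ v) ≡ T e
    moments zero    _         = solve 2 (λ t a → (t :- a) :* con (+ 1) :+ a := t) refl (T 0) (moment 0 v)
    moments (suc e) (s≤s e<n) = begin
      moment (suc e) ((y , T 0 -F moment 0 v) ∷ v)
        ≡⟨ moment-suc-cons y _ v e ⟩
      y *F moment e ((y , T 0 -F moment 0 v) ∷ v) +F moment e (reweight (_-F y) v)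
        ≡⟨ cong₂ (λ a b → y *F a +F b) (moments e (ℕ.m<n⇒m<1+n e<n)) (moment-reweight-inverse y e w y∉S) ⟩
      y *F T e +F moment e w
        ≡⟨ cong (y *F T e +F_) (w-moments e e<n) ⟩
      y *F T e +F (T (suc e) -F y *F T e)
        ≡⟨ y+[x-y]≡x (T (suc e)) (y *F T e) ⟩
      T (suc e)
        ∎

  unitAt : ℕ → ℕ → Carrier
  unitAt zero    zero    = 1F
  unitAt zero    (suc _) = 0F
  unitAt (suc _) zero    = 0F
  unitAt (suc n) (suc e) = unitAt n e

  unitAt-diagonal : ∀ n → unitAt n n ≡ 1F
  unitAt-diagonal zero    = refl
  unitAt-diagonal (suc n) = unitAt-diagonal n

  unitAt-below : ∀ {n e} → e < n → unitAt n e ≡ 0F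
  unitAt-below {suc n} {zero}  _         = refl
  unitAt-below {suc n} {suc e} (s≤s e<n) = unitAt-below e<n

  complete : ℕ → List Carrier → Carrier
  complete zero    _        = 1F
  complete (suc k) []       = 0F
  complete (suc k) (y ∷ ys) = y *F complete k (y ∷ ys) +F complete (suc k) ys

  moment-complete : ∀ n w → length w ≡ suc n → (∀ e → e < n → moment e w ≡ 0F) → moment n w ≡ 1F →
    ∀ k → moment (n + k) w ≡ complete k (nodes w)
  moment-complete zero    ((y , c) ∷ []) _ _ top = go
    where
    go : ∀ k → moment k ((y , c) ∷ []) ≡ complete k (y ∷ [])
    go zero    = top
    go (suc k) = trans (moment-suc-cons y c [] k) (cong (λ a → y *F a +F 0F) (go k))
  moment-complete (suc n) ((y , c) ∷ w) |w| low top = go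
    where
    v : Weighted
    v = reweight (_-F y) w

    v-low : ∀ e → e < n → moment e v ≡ 0F
    v-low e e<n = trans (moment-reweight-sub-cons y c w e)
      (trans (cong₂ (λ a b → a -F y *F b) (low (suc e) (s≤s e<n)) (low e (ℕ.m<n⇒m<1+n e<n))) (x-y*0≡x 0F y))

    v-top : moment n v ≡ 1F
    v-top = trans (moment-reweight-sub-cons y c w n)
      (trans (cong₂ (λ a b → a -F y *F b) top (low n (ℕ.n<1+n n))) (x-y*0≡x 1F y))

    v-complete : ∀ k → moment (n + k) v ≡ complete k (nodes w)
    v-complete k = trans (moment-complete n v (trans (List.length-map _ w) (ℕ.suc-injective |w|)) v-low v-top k)
                         (cong (complete k) (nodes-reweight _ w))

    go : ∀ k → moment (suc n + k) ((y , c) ∷ w) ≡ complete k (y ∷ nodes w)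
    go zero    = trans (cong (λ e → moment e ((y , c) ∷ w)) (ℕ.+-identityʳ (suc n))) top
    go (suc k) = begin
      moment (suc n + suc k) ((y , c) ∷ w)                        ≡⟨ moment-suc-cons y c w (n + suc k) ⟩
      y *F moment (n + suc k) ((y , c) ∷ w) +F moment (n + suc k) v
        ≡⟨ cong₂ (λ a b → y *F a +F b)
                 (trans (cong (λ e → moment e ((y , c) ∷ w)) (ℕ.+-suc n k)) (go k)) (v-complete (suc k)) ⟩
      y *F complete k (y ∷ nodes w) +F complete (suc k) (nodes w)  ∎

  combine : Carrier → Weighted → Weighted → Weighted
  combine t []            _             = []
  combine t (_ ∷ _)       []            = []
  combine t ((x , c) ∷ w) ((_ , d) ∷ v) = (x , c +F t *F d) ∷ combine t w v

  nodes-combine : ∀ t w v → nodes w ≡ nodes v → nodes (combine t w v) ≡ nodes w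
  nodes-combine t []            []            _  = refl
  nodes-combine t ((x , c) ∷ w) ((_ , d) ∷ v) eq = cong (x ∷_) (nodes-combine t w v (List.∷-injectiveʳ eq))

  moment-combine : ∀ t w v → nodes w ≡ nodes v → ∀ e → moment e (combine t w v) ≡ moment e w +F t *F moment e v
  moment-combine t [] [] _ _ = sym (x+y*0≡x 0F t)
  moment-combine t ((x , c) ∷ w) ((x′ , d) ∷ v) eq e with List.∷-injectiveˡ eq
  ... | refl = begin
    (c +F t *F d) *F pow x e +F moment e (combine t w v)
      ≡⟨ cong ((c +F t *F d) *F pow x e +F_) (moment-combine t w v (List.∷-injectiveʳ eq) e) ⟩
    (c +F t *F d) *F pow x e +F (moment e w +F t *F moment e v)
      ≡⟨ solve 6 (λ c t d p a b → (c :+ t :* d) :* p :+ (a :+ t :* b) := (c :* p :+ a) :+ t :* (d :* p :+ b))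
               refl c t d (pow x e) (moment e w) (moment e v) ⟩
    (c *F pow x e +F moment e w) +F t *F (d *F pow x e +F moment e v)
      ∎

  interpolate-with-gap : ∀ n k S → length S ≡ suc n → Unique S → complete k S ≢ 0F →
    (T : ℕ → Carrier) (c : Carrier) →
    ∃[ w ] nodes w ≡ S × (∀ e → e < n → moment e w ≡ T e) × moment (n + k) w ≡ c
  interpolate-with-gap n k S |S| S-unique nonzero T c
    with interpolate S S-unique T | interpolate S S-unique (unitAt n)
  ... | w , refl , w-moments | u , u-nodes , u-moments =
    combine t w u , nodes-combine t w u (sym u-nodes) , low , top
    where
    e<|S| : ∀ {e} → e < n → e < length (nodes w)
    e<|S| e<n = subst (_ <_) (sym |S|) (ℕ.m<n⇒m<1+n e<n)

    u-gap : moment (n + k) u ≡ complete k (nodes w)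
    u-gap = trans (moment-complete n u (trans (sym (List.length-map _ u)) (trans (cong length u-nodes) |S|))
                    (λ e e<n → trans (u-moments e (e<|S| e<n)) (unitAt-below e<n))
                    (trans (u-moments n (subst (n <_) (sym |S|) (ℕ.n<1+n n))) (unitAt-diagonal n)) k)
                  (cong (complete k) u-nodes)

    t : Carrier
    t = (c -F moment (n + k) w) *F moment (n + k) u ⁻¹

    low : ∀ e → e < n → moment e (combine t w u) ≡ T e
    low e e<n = begin
      moment e (combine t w u)      ≡⟨ moment-combine t w u (sym u-nodes) e ⟩
      moment e w +F t *F moment e u ≡⟨ cong₂ (λ a b → a +F t *F b) (w-moments e (e<|S| e<n))
                                             (trans (u-moments e (e<|S| e<n)) (unitAt-below e<n)) ⟩
      T e +F t *F 0F                ≡⟨ x+y*0≡x (T e) t ⟩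
      T e                           ∎

    top : moment (n + k) (combine t w u) ≡ c
    top = begin
      moment (n + k) (combine t w u)
        ≡⟨ moment-combine t w u (sym u-nodes) (n + k) ⟩
      M +F (c -F M) *F U ⁻¹ *F U
        ≡⟨ cong (M +F_) (*-assoc (c -F M) (U ⁻¹) U) ⟩
      M +F (c -F M) *F (U ⁻¹ *F U)
        ≡⟨ cong (λ z → M +F (c -F M) *F z) (⁻¹-inverseˡ (nonzero ∘ subst (_≡ 0F) u-gap)) ⟩
      M +F (c -F M) *F 1F
        ≡⟨ solve 2 (λ a b → a :+ (b :- a) :* con (+ 1) := b) refl M c ⟩
      c ∎
      where
      M U : Carrier
      M = moment (n + k) w
      U = moment (n + k) u

  complete-roots : ∀ k → k ≤ 2 → ∀ D → AtMostTwoRoots (λ y → complete k (y ∷ D))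
  complete-roots 0 _ _ 1≡0 _ _ _ _ _ = 0≢1 (sym 1≡0)
  complete-roots 1 _ D {a} {b} fa fb _ a≢b _ _ = a≢b (x-y≡0⇒x≡y (begin
    a -F b                                    ≡⟨ solve 3 (λ a b s → a :- b := (a :* con (+ 1) :+ s) :- (b :* con (+ 1) :+ s))
                                                       refl a b (complete 1 D) ⟩
    complete 1 (a ∷ D) -F complete 1 (b ∷ D)  ≡⟨ x≡y⇒x-y≡0 (trans fa (sym fb)) ⟩
    0F                                        ∎))
  complete-roots 2 _ D {a} {b} {c} fa fb fc a≢b a≢c b≢c = b≢c (x-y≡0⇒x≡y (begin
    b -F c                             ≡⟨ solve 4 (λ a b c s → b :- c := (a :+ b :+ s) :- (a :+ c :+ s)) refl a b c s₁ ⟩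
    (a +F b +F s₁) -F (a +F c +F s₁)   ≡⟨ x≡y⇒x-y≡0 (trans (sum-of-roots fb a≢b) (sym (sum-of-roots fc a≢c))) ⟩
    0F                                 ∎))
    where
    s₁ : Carrier
    s₁ = complete 1 D
    sum-of-roots : ∀ {b} → complete 2 (b ∷ D) ≡ 0F → a ≢ b → a +F b +F s₁ ≡ 0F
    sum-of-roots {b} fb a≢b = *-cancel-nonzeroˡ (a≢b ∘ x-y≡0⇒x≡y) (begin
      (a -F b) *F (a +F b +F s₁)                ≡⟨ solve 4 (λ a b s t → (a :- b) :* (a :+ b :+ s)
                                                      := (a :* (a :* con (+ 1) :+ s) :+ t) :- (b :* (b :* con (+ 1) :+ s) :+ t))
                                                      refl a b s₁ (complete 2 D) ⟩
      complete 2 (a ∷ D) -F complete 2 (b ∷ D)  ≡⟨ x≡y⇒x-y≡0 (trans fa (sym fb)) ⟩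
      0F                                        ∎)
  complete-roots (suc (suc (suc _))) (s≤s (s≤s ()))

module _ {V : Set} {Adj : V → V → Set} where

  infixr 5 _++ʷ_
  _++ʷ_ : ∀ {u v w n k} → Walk Adj u v n → Walk Adj v w k → Walk Adj u w (n + k)
  nil         ++ʷ walk = walk
  cons edge r ++ʷ walk = cons edge (r ++ʷ walk)

  reverse : (∀ {u v} → Adj u v → Adj v u) → ∀ {u v n} → Walk Adj u v n → Walk Adj v u n
  reverse sym-adj nil                       = nil
  reverse sym-adj (cons {n = n} edge walk) =
    subst (Walk Adj _ _) (ℕ.+-comm n 1) (reverse sym-adj walk ++ʷ cons (sym-adj edge) nil)

  zero-length⇒≡ : ∀ {u v} → Walk Adj u v 0 → u ≡ v
  zero-length⇒≡ nil = refl

lastOr : {A : Set} → A → List A → A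
lastOr x []       = x
lastOr _ (y ∷ ys) = lastOr y ys

module JumpedWengerDiameter {q : ℕ} (F : FiniteField q) (m i j : ℕ) where
  open FiniteField F
  open FiniteFieldProperties F
  open PowerSums F
  open JumpedWenger F m i j
  open ≡-Reasoning

  E : Fin (suc m) → ℕ
  E t = expo i j (toℕ t)

  Adj-sym : ∀ {u v} → Adj u v → Adj v u
  Adj-sym {inj₁ _} {inj₂ _} inc = inc
  Adj-sym {inj₂ _} {inj₁ _} inc = inc

  incident-cong : ∀ {P P′ L} → P fzero ≡ P′ fzero → (∀ t → 1 ≤ toℕ t → P t ≡ P′ t) →
    Incident P L → Incident P′ L
  incident-cong {L = L} P₀≡P′₀ P≡P′ inc t 1≤t =
    subst₂ (λ a b → L t +F a ≡ L fzero *F pow b (E t)) (P≡P′ t 1≤t) P₀≡P′₀ (inc t 1≤t)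

  lineThrough : Point → Carrier → Line
  lineThrough P a fzero    = a
  lineThrough P a (fsuc t) = a *F pow (P fzero) (E (fsuc t)) -F P (fsuc t)

  pointOn : Line → Carrier → Point
  pointOn L x fzero    = x
  pointOn L x (fsuc t) = L fzero *F pow x (E (fsuc t)) -F L (fsuc t)

  incident-lineThrough : ∀ P a → Incident P (lineThrough P a)
  incident-lineThrough P a (fsuc t) _ = [x-y]+y≡x _ (P (fsuc t))

  incident-pointOn : ∀ L x → Incident (pointOn L x) L
  incident-pointOn L x (fsuc t) _ = y+[x-y]≡x _ (L (fsuc t))

  incident-difference : ∀ {P P′ L} → Incident P L → Incident P′ L → ∀ t → 1 ≤ toℕ t →
    P′ t ≡ P t +F L fzero *F pow (P′ fzero) (E t) -F L fzero *F pow (P fzero) (E t)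
  incident-difference {P} {P′} {L} inc inc′ t 1≤t = begin
    P′ t                                              ≡⟨ solve 3 (λ p′ p l → p′ := p :+ (l :+ p′) :- (l :+ p)) refl (P′ t) (P t) (L t) ⟩
    P t +F (L t +F P′ t) -F (L t +F P t)              ≡⟨ cong₂ (λ a b → P t +F a -F b) (inc′ t 1≤t) (inc t 1≤t) ⟩
    P t +F L fzero *F pow (P′ fzero) (E t) -F L fzero *F pow (P fzero) (E t)  ∎

  walk-along : ∀ P w → ∃[ Q ] Walk Adj (inj₁ P) (inj₁ Q) (length w * 2) × Q fzero ≡ lastOr (P fzero) (nodes w) ×
    (∀ t → 1 ≤ toℕ t → Q t ≡ P t +F moment (E t) w -F moment 0 w *F pow (P fzero) (E t))
  walk-along P [] = P , nil , refl , λ t _ →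
    solve 2 (λ p x → p := p :+ con (+ 0) :- con (+ 0) :* x) refl (P t) (pow (P fzero) (E t))
  walk-along P ((x , c) ∷ w) with walk-along (pointOn (lineThrough P (moment 0 ((x , c) ∷ w))) x) w
  ... | Q , walk , Q₀ , Q-coords =
    Q , cons {w = inj₂ L} (incident-lineThrough P a) (cons (incident-pointOn L x) walk) , Q₀ , coords
    where
    a : Carrier
    a = moment 0 ((x , c) ∷ w)
    L : Line
    L = lineThrough P a
    coords : ∀ t → 1 ≤ toℕ t → Q t ≡ P t +F moment (E t) ((x , c) ∷ w) -F a *F pow (P fzero) (E t)
    coords t 1≤t = begin
      Q t
        ≡⟨ Q-coords t 1≤t ⟩
      pointOn L x t +F moment (E t) w -F moment 0 w *F pow x (E t)
        ≡⟨ cong (λ z → z +F moment (E t) w -F moment 0 w *F pow x (E t))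
                (incident-difference (incident-lineThrough P a) (incident-pointOn L x) t 1≤t) ⟩
      P t +F a *F pow x (E t) -F a *F pow (P fzero) (E t) +F moment (E t) w -F moment 0 w *F pow x (E t)
        ≡⟨ solve 6 (λ p c m₀ x′ p₀ mₑ →
                      p :+ (c :* con (+ 1) :+ m₀) :* x′ :- (c :* con (+ 1) :+ m₀) :* p₀ :+ mₑ :- m₀ :* x′
                      := p :+ (c :* x′ :+ mₑ) :- (c :* con (+ 1) :+ m₀) :* p₀)
                 refl (P t) c (moment 0 w) (pow x (E t)) (pow (P fzero) (E t)) (moment (E t) w) ⟩
      P t +F moment (E t) ((x , c) ∷ w) -F a *F pow (P fzero) (E t)
        ∎

  walk-telescope : ∀ {Q R n} → Walk Adj (inj₁ Q) (inj₁ R) (suc n) →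
    ∃[ l ] ∃[ a ] ∃[ b ] length l * 2 + 2 ≤ suc n ×
      (∀ t → 1 ≤ toℕ t → R t ≡ Q t +F b *F pow (R fzero) (E t) -F a *F pow (Q fzero) (E t) +F moment (E t) l)
  walk-telescope (cons {w = inj₂ L} inc (cons inc′ nil)) =
    [] , L fzero , L fzero , ℕ.≤-refl , λ t 1≤t → trans (incident-difference inc inc′ t 1≤t) (sym (+-identityʳ _))
  walk-telescope {Q} {R} (cons {w = inj₂ L} inc (cons {w = inj₁ Q′} inc′ rest@(cons _ _)))
    with walk-telescope rest
  ... | l , a , b , |l|≤ , R-coords = (Q′ fzero , L fzero -F a) ∷ l , L fzero , b , s≤s (s≤s |l|≤) , coords
    where
    coords : ∀ t → 1 ≤ toℕ t →
      R t ≡ Q t +F b *F pow (R fzero) (E t) -F L fzero *F pow (Q fzero) (E t) +F moment (E t) ((Q′ fzero , L fzero -F a) ∷ l)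
    coords t 1≤t = begin
      R t
        ≡⟨ R-coords t 1≤t ⟩
      Q′ t +F b *F pow (R fzero) (E t) -F a *F pow (Q′ fzero) (E t) +F moment (E t) l
        ≡⟨ cong (λ z → z +F b *F pow (R fzero) (E t) -F a *F pow (Q′ fzero) (E t) +F moment (E t) l)
                (incident-difference inc inc′ t 1≤t) ⟩
      Q t +F A *F pow (Q′ fzero) (E t) -F A *F pow (Q fzero) (E t) +F b *F pow (R fzero) (E t)
        -F a *F pow (Q′ fzero) (E t) +F moment (E t) l
        ≡⟨ solve 8 (λ q A q′ q₀ b r a mₑ →
                      q :+ A :* q′ :- A :* q₀ :+ b :* r :- a :* q′ :+ mₑ
                      := q :+ b :* r :- A :* q₀ :+ ((A :- a) :* q′ :+ mₑ))
                 refl (Q t) (L fzero) (pow (Q′ fzero) (E t)) (pow (Q fzero) (E t)) b (pow (R fzero) (E t)) a (moment (E t) l) ⟩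
      Q t +F b *F pow (R fzero) (E t) -F L fzero *F pow (Q fzero) (E t) +F moment (E t) ((Q′ fzero , L fzero -F a) ∷ l)
        ∎
      where
      A : Carrier
      A = L fzero

  module _ (1≤m : 1 ≤ m) (m≤i : m ≤ i) (m+2<q : m + 2 < q) where

    -- Total weight 0, so that P's first coordinate drops out of walk-along; then the coordinates of d.
    target : Point → ℕ → Carrier
    target d zero    = 0F
    target d (suc e) with e <? m
    ... | yes e<m = d (fsuc (fromℕ< e<m))
    ... | no _    = 0F

    target-toℕ : ∀ d t → 1 ≤ toℕ t → target d (toℕ t) ≡ d t
    target-toℕ d (fsuc t) _ with toℕ t <? m
    ... | yes t<m = cong (d ∘ fsuc) (Fin.fromℕ<-toℕ t t<m)
    ... | no  t≮m = contradiction (Fin.toℕ<n t) t≮m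

    moment-E : ∀ w (d : Point) → (∀ e → e < m → moment e w ≡ target d e) → moment (expo i j m) w ≡ d (fromℕ m) →
      ∀ t → 1 ≤ toℕ t → moment (E t) w ≡ d t
    moment-E w d low top t 1≤t with toℕ t <? m
    ... | yes t<m = begin
      moment (E t) w        ≡⟨ cong (λ e → moment e w) (expo-below j (ℕ.<-≤-trans t<m m≤i)) ⟩
      moment (toℕ t) w      ≡⟨ low (toℕ t) t<m ⟩
      target d (toℕ t)      ≡⟨ target-toℕ d t 1≤t ⟩
      d t                   ∎
    ... | no t≮m = begin
      moment (E t) w          ≡⟨ cong (λ e → moment (expo i j e) w) t≡m ⟩
      moment (expo i j m) w   ≡⟨ top ⟩
      d (fromℕ m)             ≡⟨ cong d (Fin.toℕ-injective (trans (Fin.toℕ-fromℕ m) (sym t≡m))) ⟩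
      d t                     ∎
      where
      t≡m : toℕ t ≡ m
      t≡m = ℕ.≤-antisym (ℕ.≤-pred (Fin.toℕ<n t)) (ℕ.≮⇒≥ t≮m)

    pred-m<q : pred m < q
    pred-m<q = ℕ.≤-<-trans ℕ.pred[n]≤n (ℕ.≤-<-trans (ℕ.m≤m+n m 2) m+2<q)

    2+m<q : 2 + m < q
    2+m<q = subst (_< q) (ℕ.+-comm m 2) m+2<q

    length-∷-pred : ∀ (x : Carrier) zs → length zs ≡ pred m → length (x ∷ zs) ≡ m
    length-∷-pred _ _ |zs| = trans (cong suc |zs|) (ℕ.suc-pred m ⦃ Data.Nat.>-nonZero 1≤m ⦄)

    displace : ∀ P → ∃[ x ] ∀ (d : Point) →
      ∃[ Q ] Walk Adj (inj₁ P) (inj₁ Q) (m * 2) × Q fzero ≡ x × (∀ t → 1 ≤ toℕ t → Q t ≡ P t +F d t)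
    displace P with ∃-unique-extension (pred m) (P fzero) pred-m<q | expo-gap i j m
    ... | zs , |zs| , D-unique | k , k≤2 , γ≡m+k
      with ∃-fresh-nonroot (λ y → complete k (y ∷ P fzero ∷ zs)) (complete-roots k k≤2 (P fzero ∷ zs))
                           (P fzero ∷ zs) (subst (λ n → 2 + n < q) (sym (length-∷-pred (P fzero) zs |zs|)) 2+m<q)
    ... | y , y∉D , nonroot = lastOr y zs , reach
      where
      |D| : length (P fzero ∷ zs) ≡ m
      |D| = length-∷-pred (P fzero) zs |zs|

      reach : ∀ d → ∃[ Q ] Walk Adj (inj₁ P) (inj₁ Q) (m * 2) × Q fzero ≡ lastOr y zs × (∀ t → 1 ≤ toℕ t → Q t ≡ P t +F d t)
      reach d with interpolate-with-gap m k (y ∷ P fzero ∷ zs) (cong suc |D|) (y∉D ∷ D-unique) nonroot (target d) (d (fromℕ m))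
      ... | (y , c) ∷ (_ , c₀) ∷ rest , refl , low , top =
        let Q , walk , Q₀ , Q-coords = walk-along P ((y , c) ∷ rest)
        in Q , subst (Walk Adj _ _) |walk|≡m*2 walk , Q₀ , λ t 1≤t → trans (Q-coords t 1≤t) (coords t 1≤t)
        where
        |walk|≡m*2 : length ((y , c) ∷ rest) * 2 ≡ m * 2
        |walk|≡m*2 = cong (_* 2) (trans (cong suc (sym (List.length-map proj₁ rest))) |D|)
        w : Weighted
        w = (y , c) ∷ (P fzero , c₀) ∷ rest

        -- The weight c₀ sits at P's own first coordinate, where it contributes nothing.
        coords : ∀ t → 1 ≤ toℕ t →
          P t +F moment (E t) ((y , c) ∷ rest) -F moment 0 ((y , c) ∷ rest) *F pow (P fzero) (E t) ≡ P t +F d t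
        coords t 1≤t = begin
          P t +F moment (E t) ((y , c) ∷ rest) -F moment 0 ((y , c) ∷ rest) *F pow (P fzero) (E t)
            ≡⟨ solve 7 (λ p c y′ mₑ m₀ x c₀ →
                          p :+ (c :* y′ :+ mₑ) :- (c :* con (+ 1) :+ m₀) :* x
                          := p :+ (c :* y′ :+ (c₀ :* x :+ mₑ)) :- (c :* con (+ 1) :+ (c₀ :* con (+ 1) :+ m₀)) :* x)
                     refl (P t) c (pow y (E t)) (moment (E t) rest) (moment 0 rest) (pow (P fzero) (E t)) c₀ ⟩
          P t +F moment (E t) w -F moment 0 w *F pow (P fzero) (E t)
            ≡⟨ cong (λ z → P t +F moment (E t) w -F z *F pow (P fzero) (E t)) (low 0 1≤m) ⟩
          P t +F moment (E t) w -F 0F *F pow (P fzero) (E t)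
            ≡⟨ solve 3 (λ p a x → p :+ a :- con (+ 0) :* x := p :+ a) refl (P t) (moment (E t) w) (pow (P fzero) (E t)) ⟩
          P t +F moment (E t) w
            ≡⟨ cong (P t +F_) (moment-E w d low (subst (λ e → moment e w ≡ d (fromℕ m)) (sym γ≡m+k) top) t 1≤t) ⟩
          P t +F d t
            ∎

    walk-to-line : ∀ P L → Walk Adj (inj₁ P) (inj₂ L) (m * 2 + 1)
    walk-to-line P L with displace P
    ... | x , reach with reach (λ t → pointOn L x t -F P t)
    ...   | Q , walk , Q₀ , Q-coords = walk ++ʷ cons {w = inj₂ L} Q~L nil
      where
      Q~L : Incident Q L
      Q~L = incident-cong (sym Q₀) (λ t 1≤t → sym (trans (Q-coords t 1≤t) (y+[x-y]≡x _ (P t)))) (incident-pointOn L x)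

    walk-to-point : ∀ P P′ → Walk Adj (inj₁ P) (inj₁ P′) (m * 2 + 1 + 1)
    walk-to-point P P′ = walk-to-line P (lineThrough P′ 0F) ++ʷ cons (incident-lineThrough P′ 0F) nil

    walk-from-line : ∀ L P → Walk Adj (inj₂ L) (inj₁ P) (m * 2 + 1)
    walk-from-line L P = reverse Adj-sym (walk-to-line P L)

    walk-between-lines : ∀ L L′ → Walk Adj (inj₂ L) (inj₂ L′) (suc (m * 2 + 1))
    walk-between-lines L L′ = cons {w = inj₁ (pointOn L 0F)} (incident-pointOn L 0F) (walk-to-line (pointOn L 0F) L′)

    m*2+2≡diameter : m * 2 + 2 ≡ 2 * (m + 1)
    m*2+2≡diameter = trans (cong (_+ 2) (ℕ.*-comm m 2)) (sym (ℕ.*-distribˡ-+ 2 m 1))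

    walk-of-length≤2m+2 : ∀ u v → ∃[ k ] k ≤ m * 2 + 2 × Walk Adj u v k
    walk-of-length≤2m+2 (inj₁ P) (inj₁ P′) = _ , ℕ.≤-reflexive (ℕ.+-assoc (m * 2) 1 1) , walk-to-point P P′
    walk-of-length≤2m+2 (inj₁ P) (inj₂ L)  = _ , ℕ.+-monoʳ-≤ (m * 2) (s≤s z≤n) , walk-to-line P L
    walk-of-length≤2m+2 (inj₂ L) (inj₁ P)  = _ , ℕ.+-monoʳ-≤ (m * 2) (s≤s z≤n) , walk-from-line L P
    walk-of-length≤2m+2 (inj₂ L) (inj₂ L′) = _ , ℕ.≤-reflexive (sym (ℕ.+-suc (m * 2) 1)) , walk-between-lines L L′

    origin : Point
    origin _ = 0F

    unitPoint : Point
    unitPoint t = unitAt m (toℕ t)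

    unitPoint-top : unitPoint (fromℕ m) ≡ 1F
    unitPoint-top = trans (cong (unitAt m) (Fin.toℕ-fromℕ m)) (unitAt-diagonal m)

    short-walk-impossible : ∀ {n} → Walk Adj (inj₁ origin) (inj₁ unitPoint) (suc n) → suc n < 2 * (m + 1) → ⊥
    short-walk-impossible walk short with walk-telescope walk
    ... | l , a , b , |l|≤ , coords = 0≢1 (begin
      0F                             ≡⟨ sym (positive-moment γ 1≤γ) ⟩
      moment γ l                     ≡⟨ sym (unitPoint-moment (fromℕ m) 1≤toℕ[m]) ⟩
      unitPoint (fromℕ m)            ≡⟨ unitPoint-top ⟩
      1F                             ∎)
      where
      |l|<m : length l < m
      |l|<m = ℕ.*-cancelʳ-< 2 (length l) m
                (ℕ.+-cancelʳ-< 2 (length l * 2) (m * 2) (ℕ.<-≤-trans (ℕ.≤-<-trans |l|≤ short) (ℕ.≤-reflexive (sym m*2+2≡diameter))))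

      pow-0 : ∀ e → 1 ≤ e → pow 0F e ≡ 0F
      pow-0 (suc e) _ = zeroˡ (pow 0F e)

      unitPoint-moment : ∀ t → 1 ≤ toℕ t → unitAt m (toℕ t) ≡ moment (E t) l
      unitPoint-moment t 1≤t = begin
        unitAt m (toℕ t)
          ≡⟨ coords t 1≤t ⟩
        0F +F b *F pow (unitPoint fzero) (E t) -F a *F pow 0F (E t) +F moment (E t) l
          ≡⟨ cong₂ (λ z z′ → 0F +F b *F z -F a *F z′ +F moment (E t) l)
                   (trans (cong (λ x → pow x (E t)) (unitAt-below 1≤m)) pow0) pow0 ⟩
        0F +F b *F 0F -F a *F 0F +F moment (E t) l
          ≡⟨ solve 3 (λ a b x → con (+ 0) :+ b :* con (+ 0) :- a :* con (+ 0) :+ x := x) refl a b (moment (E t) l) ⟩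
        moment (E t) l
          ∎
        where
        pow0 : pow 0F (E t) ≡ 0F
        pow0 = pow-0 (E t) (ℕ.≤-trans 1≤t (expo-≥ i j (toℕ t)))

      low : ∀ e → e < length l → moment (suc e) l ≡ 0F
      low e e<|l| = begin
        moment (suc e) l           ≡⟨ cong (λ s → moment s l) (sym E[t]≡1+e) ⟩
        moment (E t) l             ≡⟨ sym (unitPoint-moment t (subst (1 ≤_) (sym toℕ[t]≡1+e) (s≤s z≤n))) ⟩
        unitAt m (toℕ t)           ≡⟨ cong (unitAt m) toℕ[t]≡1+e ⟩
        unitAt m (suc e)           ≡⟨ unitAt-below 1+e<m ⟩
        0F                         ∎
        where
        1+e<m : suc e < m
        1+e<m = ℕ.<-≤-trans (s≤s e<|l|) |l|<m
        t : Fin (suc m)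
        t = fromℕ< (ℕ.m<n⇒m<1+n 1+e<m)
        toℕ[t]≡1+e : toℕ t ≡ suc e
        toℕ[t]≡1+e = Fin.toℕ-fromℕ< (ℕ.m<n⇒m<1+n 1+e<m)
        E[t]≡1+e : E t ≡ suc e
        E[t]≡1+e = trans (cong (expo i j) toℕ[t]≡1+e) (expo-below j (ℕ.<-≤-trans 1+e<m m≤i))

      positive-moment : ∀ e → 1 ≤ e → moment e l ≡ 0F
      positive-moment (suc e) _ = positive-moments-vanish l low e

      1≤toℕ[m] : 1 ≤ toℕ (fromℕ m)
      1≤toℕ[m] = subst (1 ≤_) (sym (Fin.toℕ-fromℕ m)) 1≤m

      γ : ℕ
      γ = E (fromℕ m)
      1≤γ : 1 ≤ γ
      1≤γ = ℕ.≤-trans 1≤toℕ[m] (expo-≥ i j (toℕ (fromℕ m)))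

    walk-at-least-diameter : ∀ k → Walk Adj (inj₁ origin) (inj₁ unitPoint) k → 2 * (m + 1) ≤ k
    walk-at-least-diameter zero walk =
      ⊥-elim (0≢1 (trans (cong (λ P → P (fromℕ m)) (Sum.inj₁-injective (zero-length⇒≡ walk))) unitPoint-top))
    walk-at-least-diameter (suc n) walk with 2 * (m + 1) ≤? suc n
    ... | yes long = long
    ... | no short = ⊥-elim (short-walk-impossible walk (ℕ.≰⇒> short))

    within-diameter : ∀ u v → ∃[ k ] k ≤ 2 * (m + 1) × Walk Adj u v k
    within-diameter u v = let k , k≤ , walk = walk-of-length≤2m+2 u v in k , subst (k ≤_) m*2+2≡diameter k≤ , walk

    diameter : HasDiameter Adj (2 * (m + 1))
    diameter = within-diameter , inj₁ origin , inj₁ unitPoint , walk-at-least-diameter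

theorem2 : (p e q : ℕ) → Prime p → 1 ≤ e → q ≡ p ^ e → (F : FiniteField q) →
    (m : ℕ) → 1 ≤ m → m + 2 < q → (i j : ℕ) →
    ((i ≡ m × j ≡ m + 2) ⊎ (i ≡ m + 1 × j ≡ m + 2) ⊎ (i ≡ m × j ≡ m + 1)) →
    HasDiameter (JumpedWenger.Adj F m i j) (2 * (m + 1))
theorem2 _ _ q _ _ _ F m 1≤m m+2<q i j cases = JumpedWengerDiameter.diameter F m i j 1≤m (m≤i cases) m+2<q
  where
  m≤i : (i ≡ m × j ≡ m + 2) ⊎ (i ≡ m + 1 × j ≡ m + 2) ⊎ (i ≡ m × j ≡ m + 1) → m ≤ i
  m≤i (inj₁ (i≡m , _))          = ℕ.≤-reflexive (sym i≡m)
  m≤i (inj₂ (inj₁ (i≡m+1 , _))) = subst (m ≤_) (sym i≡m+1) (ℕ.m≤m+n m 1)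
  m≤i (inj₂ (inj₂ (i≡m , _)))   = ℕ.≤-reflexive (sym i≡m)
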